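{- Let $\ell\in\mathbb{N}\cup\{0\}$. For integers $n\ge0$ and $j\ge1$, let $P_\ell(j,n)$ be the number of partitions of $n$ whose smallest part $j$ appears exactly $j+\ell$ times and whose other parts are distinct (and larger than $j$), and let $P_\ell(0,n)$ be the number of partitions of $n$ into distinct parts. Then \[ \sum_{j=0}^{n}(-1)^jP_\ell(j,n)=b_\ell(n), \] where $b_\ell(n)$ is the number of generalized non-Rascoe partitions of $n$ associated with $\ell$.
   Context: A generalized non-Rascoe partition of $N$ associated with $\ell$ is a partition of $N$ into distinct parts such that (number of parts) $+\ell$ is not a part; the empty partition counts as one such partition of $0$. -}

module Defs where

open import Data.Nat using (ℕ; zero; suc; _+_; _*_; _∸_; _≤_; _≤?_; _≟_)
open import Data.Integer as ℤ using (ℤ; +_; -1ℤ)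
open import Data.List using (List; []; _∷_; [_]; map; concatMap; filter; length; sum; applyUpTo; upTo; foldr)
open import Data.List.Relation.Unary.All using (All; all?)
open import Data.List.Relation.Unary.Unique.Propositional using (Unique)
import Data.List.Relation.Unary.Unique.DecPropositional as UDec
open import Data.List.Membership.Propositional using (_∈_)
open import Data.List.Membership.DecPropositional _≟_ using (_∈?_)
open import Data.Product using (_×_)
open import Relation.Binary.PropositionalEquality using (_≡_)
open import Relation.Nullary using (¬_; Dec; ¬?)
open import Relation.Nullary.Decidable using (_×-dec_)

-- A partition of n is represented as a non-increasing list of positive
-- integers summing to n (the list of parts, with multiplicity).
-- genParts fuel n m : all non-increasing lists of parts in {1,…,m} summing to n.
-- (fuel ≥ n suffices since each part is ≥ 1.)
genParts : ℕ → ℕ → ℕ → List (List ℕ)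
genParts _        zero    _ = [ [] ]
genParts zero     (suc _) _ = []
genParts (suc f)  n       m =
  concatMap (λ k → map (k ∷_) (genParts f (n ∸ k) k))
            (filter (λ k → k ≤? n) (applyUpTo suc m))

partitions : ℕ → List (List ℕ)
partitions n = genParts n n n

countParts : {P : List ℕ → Set} → ((λs : List ℕ) → Dec (P λs)) → ℕ → ℕ
countParts P? n = length (filter P? (partitions n))

mult : ℕ → List ℕ → ℕ
mult j λs = length (filter (λ x → x ≟ j) λs)

otherParts : ℕ → List ℕ → List ℕ
otherParts j λs = filter (λ x → ¬? (x ≟ j)) λs

Distinct : List ℕ → Set
Distinct = Unique

distinct? : (λs : List ℕ) → Dec (Distinct λs)
distinct? = UDec.unique? _≟_

-- For j ≥ 1: smallest part is j, j appears exactly j + ℓ times,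
-- the other parts are distinct (and, being ≥ j and ≠ j, larger than j).
SmallestRep : ℕ → ℕ → List ℕ → Set
SmallestRep ℓ j λs = All (j ≤_) λs × (mult j λs ≡ (j + ℓ)) × Unique (otherParts j λs)

smallestRep? : (ℓ j : ℕ) → (λs : List ℕ) → Dec (SmallestRep ℓ j λs)
smallestRep? ℓ j λs =
  all? (λ x → j ≤? x) λs ×-dec (mult j λs ≟ (j + ℓ)) ×-dec UDec.unique? _≟_ (otherParts j λs)

P : ℕ → ℕ → ℕ → ℕ
P ℓ zero    n = countParts distinct? n
P ℓ (suc j) n = countParts (smallestRep? ℓ (suc j)) n

NonRascoe : ℕ → List ℕ → Set
NonRascoe ℓ λs = Distinct λs × ¬ ((length λs + ℓ) ∈ λs)

nonRascoe? : (ℓ : ℕ) → (λs : List ℕ) → Dec (NonRascoe ℓ λs)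
nonRascoe? ℓ λs = distinct? λs ×-dec ¬? ((length λs + ℓ) ∈? λs)

b : ℕ → ℕ → ℕ
b ℓ n = countParts (nonRascoe? ℓ) n

altSum : ℕ → ℕ → ℤ
altSum ℓ n = foldr ℤ._+_ (+ 0) (map (λ j → (-1ℤ ℤ.^ j) ℤ.* (+ P ℓ j n)) (upTo (suc n)))

{-# OPTIONS --safe #-}
module Submission where

-- For j ≥ 1, a partition counted by P ℓ j n is a set μ of distinct parts above j plus a block
-- of j + ℓ copies of j, so its size is sum μ + (j + ℓ) j; for j = 0 it is just μ. Call
-- |μ| + ℓ + 2j the pivot of μ, and let P∉ j n count those partitions whose μ does not contain
-- its pivot. Deleting the pivot from μ and raising every other part by one is a bijection from
-- the partitions whose μ contains its pivot onto those counted by P∉ (j + 1) n: the new pivot is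
-- the old one plus one, and the size is preserved since (j+1+ℓ)(j+1) − (j+ℓ)j = 2j+1+ℓ. Hence
-- P ℓ j n = P∉ (j + 1) n + P∉ j n, so the alternating sum telescopes to P∉ 0 n, as
-- P∉ (n + 1) n = 0. For j = 0 the pivot is (number of parts) + ℓ, so P∉ 0 n = b ℓ n.

open import Defs
open import Data.Integer as ℤ using (ℤ; +_; -1ℤ; 0ℤ)
import Data.Integer.Properties as ℤ
import Data.Integer.Tactic.RingSolver as ℤ-Ring
open import Data.List
  using (List; []; _∷_; _++_; map; concatMap; filter; length; replicate; applyUpTo; foldr)
open import Data.List.Properties
  using (length-map; map-∘; map-id; map-id-local; map-upTo; filter-accept; filter-reject;
         filter-all; filter-none; filter-++; length-++; length-replicate; ++-identityʳ;
         ∷-injectiveˡ; ∷-injectiveʳ; map-applyUpTo)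
open import Data.List.Membership.Propositional using (_∈_; _∉_; find; lose)
open import Data.List.Membership.Propositional.Properties
  using (∈-map⁺; ∈-map⁻; ∈-filter⁺; ∈-filter⁻; ∈-concatMap⁺; ∈-concatMap⁻;
         ∈-applyUpTo⁺; ∈-applyUpTo⁻)
open import Data.List.Membership.Propositional.Properties.WithK using (unique∧set⇒bag)
open import Data.List.Relation.Binary.BagAndSetEquality using (∼bag⇒↭)
open import Data.List.Relation.Binary.Permutation.Propositional
  using (_↭_; ↭-refl; ↭-sym; ↭-trans; ↭-reflexive; prep; swap; module PermutationReasoning)
open import Data.List.Relation.Binary.Permutation.Propositional.Properties
  using (↭-length; All-resp-↭; ∈-resp-↭)
open import Data.List.Relation.Unary.All as All using (All; []; _∷_)
import Data.List.Relation.Unary.All.Properties as All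
open import Data.List.Relation.Unary.AllPairs as AllPairs using (AllPairs; []; _∷_)
import Data.List.Relation.Unary.AllPairs.Properties as AllPairs
open import Data.List.Relation.Unary.Any using (here; there)
open import Data.List.Relation.Unary.Unique.Propositional using (Unique)
import Data.List.Relation.Unary.Unique.Propositional.Properties as Unique
open import Data.Nat
  using (ℕ; zero; suc; pred; _+_; _*_; _∸_; _≤_; _<_; _≥_; _>_; _≤?_; _<?_; _≟_; z≤n; s≤s; z<s; s<s⁻¹)
open import Data.Nat.ListAction using (sum)
open import Data.Nat.ListAction.Properties using (sum-++; sum-↭)
open import Data.Nat.Properties
  using (≤-refl; ≤-trans; ≤-antisym; <-trans; ≤∧≢⇒<; <⇒≤; >⇒≢; ≮⇒≥;
         +-suc; +-identityʳ; *-zeroʳ; m≤m+n; m≤n+m; m≤n*m; m+n∸m≡n; m+[n∸m]≡n; suc-injective; n≮n)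
import Data.Nat.Tactic.RingSolver as ℕ-Ring
open import Data.List.Membership.DecPropositional _≟_ using (_∈?_)
open import Data.Product using (_×_; _,_; proj₁; proj₂)
open import Function using (_∘_; _⇔_; mk⇔)
open import Relation.Binary.PropositionalEquality
  using (_≡_; _≢_; refl; sym; trans; cong; cong₂; subst; subst₂; module ≡-Reasoning)
open import Relation.Nullary using (Dec; yes; no; ¬_; ¬?; contradiction)
open import Relation.Nullary.Decidable using (_×-dec_)
open import Relation.Unary using (Decidable)

NonIncreasing : List ℕ → Set
NonIncreasing = AllPairs _≥_

Decreasing : List ℕ → Set
Decreasing = AllPairs _>_

IsPartition : List ℕ → Set
IsPartition xs = NonIncreasing xs × All (0 <_) xs

DistinctAbove : ℕ → List ℕ → Set
DistinctAbove lo xs = Decreasing xs × All (lo <_) xs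

nonIncreasing∧unique⇒decreasing : ∀ {xs} → NonIncreasing xs → Unique xs → Decreasing xs
nonIncreasing∧unique⇒decreasing xs↓ xs! =
  AllPairs.zipWith (λ (y≤x , x≢y) → ≤∧≢⇒< y≤x (x≢y ∘ sym)) (xs↓ , xs!)

decreasing⇒nonIncreasing : ∀ {xs} → Decreasing xs → NonIncreasing xs
decreasing⇒nonIncreasing = AllPairs.map <⇒≤

decreasing⇒unique : ∀ {xs} → Decreasing xs → Unique xs
decreasing⇒unique = AllPairs.map >⇒≢

parts≤sum : ∀ xs → All (_≤ sum xs) xs
parts≤sum []       = []
parts≤sum (x ∷ xs) = m≤m+n x (sum xs) ∷ All.map (λ y≤Σ → ≤-trans y≤Σ (m≤n+m (sum xs) x)) (parts≤sum xs)

genParts-sound : ∀ f n m {xs} → xs ∈ genParts f n m → IsPartition xs × All (_≤ m) xs × sum xs ≡ n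
genParts-sound f       zero    m (here refl) = ([] , []) , [] , refl
genParts-sound (suc f) (suc n) m {xs} xs∈
  with k , k∈ , xs∈k ← find (∈-concatMap⁻ (λ k → map (k ∷_) (genParts f (suc n ∸ k) k))
                                {xs = filter (_≤? suc n) (applyUpTo suc m)} xs∈)
  with k∈m , k≤n ← ∈-filter⁻ (_≤? suc n) {xs = applyUpTo suc m} k∈
  with ys , ys∈ , refl ← ∈-map⁻ (k ∷_) xs∈k
  with i , i<m , refl ← ∈-applyUpTo⁻ suc k∈m
  with (ys↓ , ys⁺) , ys≤k , Σys ← genParts-sound f (suc n ∸ k) k ys∈
  = (ys≤k ∷ ys↓ , z<s ∷ ys⁺)
  , i<m ∷ All.map (λ y≤k → ≤-trans y≤k i<m) ys≤k
  , trans (cong (λ s → k + s) Σys) (m+[n∸m]≡n k≤n)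

genParts-complete : ∀ f n m {xs} → IsPartition xs → All (_≤ m) xs → sum xs ≡ n → n ≤ f →
                    xs ∈ genParts f n m
genParts-complete f       n m {[]}         _                       _           refl _  = here refl
genParts-complete f       n m {zero  ∷ xs} (_ , () ∷ _)            _           _    _
genParts-complete zero    n m {suc x ∷ xs} _                       _           refl ()
genParts-complete (suc f) n m {suc x ∷ xs} (x≥xs ∷ xs↓ , _ ∷ xs⁺) (x<m ∷ _) refl (s≤s n≤f) =
  ∈-concatMap⁺ branch (lose {P = λ k → suc x ∷ xs ∈ branch k} k∈ (∈-map⁺ (suc x ∷_) xs∈))
  where
  branch : ℕ → List (List ℕ)
  branch k = map (k ∷_) (genParts f (suc (x + sum xs) ∸ k) k)
  k∈ : suc x ∈ filter (_≤? suc (x + sum xs)) (applyUpTo suc m)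
  k∈ = ∈-filter⁺ (_≤? suc (x + sum xs)) (∈-applyUpTo⁺ suc x<m) (s≤s (m≤m+n x (sum xs)))
  xs∈ : xs ∈ genParts f (x + sum xs ∸ x) (suc x)
  xs∈ = subst (λ s → xs ∈ genParts f s (suc x)) (sym (m+n∸m≡n x (sum xs)))
          (genParts-complete f (sum xs) (suc x) (xs↓ , xs⁺) x≥xs refl (≤-trans (m≤n+m (sum xs) x) n≤f))

unique-concatMap-∷ : ∀ {A : Set} {ks : List A} (L : A → List (List A)) →
                     Unique ks → (∀ k → Unique (L k)) → Unique (concatMap (λ k → map (k ∷_) (L k)) ks)
unique-concatMap-∷ {ks = []}     L []          L! = []
unique-concatMap-∷ {ks = k ∷ ks} L (k∉ks ∷ ks!) L! =
  Unique.++⁺ (Unique.map⁺ ∷-injectiveʳ (L! k)) (unique-concatMap-∷ L ks! L!) disjoint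
  where
  disjoint : ∀ {v} → ¬ (v ∈ map (k ∷_) (L k) × v ∈ concatMap (λ k → map (k ∷_) (L k)) ks)
  disjoint (v∈k , v∈ks)
    with _ , _ , refl ← ∈-map⁻ (k ∷_) v∈k
    with k′ , k′∈ks , v∈k′ ← find (∈-concatMap⁻ (λ k → map (k ∷_) (L k)) {xs = ks} v∈ks)
    with _ , _ , eq ← ∈-map⁻ (k′ ∷_) v∈k′
    = All.lookup k∉ks k′∈ks (∷-injectiveˡ eq)

genParts-unique : ∀ f n m → Unique (genParts f n m)
genParts-unique f       zero    m = [] ∷ []
genParts-unique zero    (suc n) m = []
genParts-unique (suc f) (suc n) m =
  unique-concatMap-∷ (λ k → genParts f (suc n ∸ k) k)
    (Unique.filter⁺ (_≤? suc n)
      (subst Unique (map-applyUpTo (λ i → i) suc m) (Unique.map⁺ suc-injective (Unique.upTo⁺ m))))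
    (λ k → genParts-unique f (suc n ∸ k) k)

∈-partitions⁻ : ∀ {n xs} → xs ∈ partitions n → IsPartition xs × sum xs ≡ n
∈-partitions⁻ {n} xs∈ with xs⇃ , _ , Σxs ← genParts-sound n n n xs∈ = xs⇃ , Σxs

∈-partitions⁺ : ∀ {xs} → IsPartition xs → xs ∈ partitions (sum xs)
∈-partitions⁺ {xs} xs⇃ = genParts-complete (sum xs) (sum xs) (sum xs) xs⇃ (parts≤sum xs) refl ≤-refl

partitions-unique : ∀ n → Unique (partitions n)
partitions-unique n = genParts-unique n n n

module _ {A : Set} {P Q : A → Set} (P? : Decidable P) (Q? : Decidable Q) where

  length-filter-split : ∀ xs → length (filter P? xs) ≡
    length (filter (λ x → P? x ×-dec Q? x) xs) + length (filter (λ x → P? x ×-dec ¬? (Q? x)) xs)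
  length-filter-split []       = refl
  length-filter-split (x ∷ xs) with P? x | Q? x
  ... | yes _ | yes _ = cong suc (length-filter-split xs)
  ... | yes _ | no  _ = trans (cong suc (length-filter-split xs)) (sym (+-suc _ _))
  ... | no  _ | yes _ = length-filter-split xs
  ... | no  _ | no  _ = length-filter-split xs

length-≡-by-inverses : ∀ {A B : Set} {xs : List A} {ys : List B} (f : A → B) (g : B → A) →
  Unique xs → Unique ys →
  (∀ {x} → x ∈ xs → f x ∈ ys × g (f x) ≡ x) → (∀ {y} → y ∈ ys → g y ∈ xs × f (g y) ≡ y) →
  length xs ≡ length ys
length-≡-by-inverses {xs = xs} {ys} f g xs! ys! forward backward = begin
  length xs         ≡⟨ length-map f xs ⟨
  length (map f xs) ≡⟨ ↭-length (∼bag⇒↭ (unique∧set⇒bag fxs! ys! same-elements)) ⟩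
  length ys         ∎
  where
  open ≡-Reasoning
  g∘f≗id : map g (map f xs) ≡ xs
  g∘f≗id = trans (sym (map-∘ xs)) (map-id-local (All.tabulate (proj₂ ∘ forward)))
  fxs! : Unique (map f xs)
  fxs! = Unique.map⁻ {f = g} (subst Unique (sym g∘f≗id) xs!)
  same-elements : ∀ {y} → y ∈ map f xs ⇔ y ∈ ys
  same-elements = mk⇔ into onto
    where
    into : ∀ {y} → y ∈ map f xs → y ∈ ys
    into y∈ with _ , x∈ , refl ← ∈-map⁻ f y∈ = proj₁ (forward x∈)
    onto : ∀ {y} → y ∈ ys → y ∈ map f xs
    onto y∈ = subst (_∈ map f xs) (proj₂ (backward y∈)) (∈-map⁺ f (proj₁ (backward y∈)))

insertDesc : ℕ → List ℕ → List ℕ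
insertDesc v []       = v ∷ []
insertDesc v (x ∷ xs) with v <? x
... | yes _ = x ∷ insertDesc v xs
... | no  _ = v ∷ x ∷ xs

insertDesc-↭ : ∀ v xs → insertDesc v xs ↭ v ∷ xs
insertDesc-↭ v []       = ↭-refl
insertDesc-↭ v (x ∷ xs) with v <? x
... | yes _ = ↭-trans (prep x (insertDesc-↭ v xs)) (swap x v ↭-refl)
... | no  _ = ↭-refl

insertDesc-head : ∀ {v xs} → All (_< v) xs → insertDesc v xs ≡ v ∷ xs
insertDesc-head {v} {[]}     []           = refl
insertDesc-head {v} {x ∷ xs} (x<v ∷ _) with v <? x
... | yes v<x = contradiction (<-trans x<v v<x) (n≮n x)
... | no  _   = refl

insertDesc-below : ∀ {v x} xs → v < x → insertDesc v (x ∷ xs) ≡ x ∷ insertDesc v xs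
insertDesc-below {v} {x} xs v<x with v <? x
... | yes _   = refl
... | no  v≮x = contradiction v<x v≮x

insertDesc-decreasing : ∀ {v xs} → Decreasing xs → v ∉ xs → Decreasing (insertDesc v xs)
insertDesc-decreasing {v} {[]}     []           _  = [] ∷ []
insertDesc-decreasing {v} {x ∷ xs} (x>xs ∷ xs↓) v∉ with v <? x
... | yes v<x = All-resp-↭ (↭-sym (insertDesc-↭ v xs)) (v<x ∷ x>xs) ∷ insertDesc-decreasing xs↓ (v∉ ∘ there)
... | no  v≮x = (x<v ∷ All.map (λ y<x → <-trans y<x x<v) x>xs) ∷ x>xs ∷ xs↓
  where
  x<v : x < v
  x<v = ≤∧≢⇒< (≮⇒≥ v≮x) (λ x≡v → v∉ (here (sym x≡v)))

module _ {v : ℕ} where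

  otherParts-self : ∀ xs → otherParts v (v ∷ xs) ≡ otherParts v xs
  otherParts-self xs = filter-reject (λ x → ¬? (x ≟ v)) (λ v≢v → v≢v refl)

  otherParts-other : ∀ {x} xs → x ≢ v → otherParts v (x ∷ xs) ≡ x ∷ otherParts v xs
  otherParts-other xs = filter-accept (λ x → ¬? (x ≟ v))

  mult-self : ∀ xs → mult v (v ∷ xs) ≡ suc (mult v xs)
  mult-self xs = cong length (filter-accept (_≟ v) refl)

  mult-other : ∀ {x} xs → x ≢ v → mult v (x ∷ xs) ≡ mult v xs
  mult-other xs x≢v = cong length (filter-reject (_≟ v) x≢v)

  otherParts-∉ : ∀ {xs} → v ∉ xs → otherParts v xs ≡ xs
  otherParts-∉ {xs} v∉ = filter-all (λ x → ¬? (x ≟ v)) (All.tabulate (λ x∈ x≡v → v∉ (subst (_∈ xs) x≡v x∈)))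

  ∉-otherParts : ∀ xs → v ∉ otherParts v xs
  ∉-otherParts xs v∈ = proj₂ (∈-filter⁻ (λ x → ¬? (x ≟ v)) {xs = xs} v∈) refl

  otherParts-↭ : ∀ {xs} → Unique xs → v ∈ xs → xs ↭ v ∷ otherParts v xs
  otherParts-↭ {x ∷ xs} (x∉xs ∷ _) (here refl) =
    ↭-reflexive (cong (x ∷_) (sym (trans (otherParts-self xs) (otherParts-∉ (λ x∈ → All.lookup x∉xs x∈ refl)))))
  otherParts-↭ {x ∷ xs} (x∉xs ∷ xs!) (there v∈xs) = begin
    x ∷ xs                      ↭⟨ prep x (otherParts-↭ xs! v∈xs) ⟩
    x ∷ v ∷ otherParts v xs     ↭⟨ swap x v ↭-refl ⟩
    v ∷ x ∷ otherParts v xs     ≡⟨ cong (v ∷_) (otherParts-other xs (All.lookup x∉xs v∈xs)) ⟨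
    v ∷ otherParts v (x ∷ xs)   ∎
    where open PermutationReasoning

  insertDesc-otherParts : ∀ {xs} → Decreasing xs → v ∈ xs → insertDesc v (otherParts v xs) ≡ xs
  insertDesc-otherParts {x ∷ xs} (x>xs ∷ _) (here refl) = begin
    insertDesc x (otherParts x (x ∷ xs)) ≡⟨ cong (insertDesc x) (otherParts-self xs) ⟩
    insertDesc x (otherParts x xs)       ≡⟨ cong (insertDesc x) (otherParts-∉ (n≮n x ∘ All.lookup x>xs)) ⟩
    insertDesc x xs                      ≡⟨ insertDesc-head x>xs ⟩
    x ∷ xs                               ∎
    where open ≡-Reasoning
  insertDesc-otherParts {x ∷ xs} (x>xs ∷ xs↓) (there v∈xs) = begin
    insertDesc v (otherParts v (x ∷ xs)) ≡⟨ cong (insertDesc v) (otherParts-other xs (>⇒≢ v<x)) ⟩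
    insertDesc v (x ∷ otherParts v xs)   ≡⟨ insertDesc-below (otherParts v xs) v<x ⟩
    x ∷ insertDesc v (otherParts v xs)   ≡⟨ cong (x ∷_) (insertDesc-otherParts xs↓ v∈xs) ⟩
    x ∷ xs                               ∎
    where
    open ≡-Reasoning
    v<x : v < x
    v<x = All.lookup x>xs v∈xs

  otherParts-insertDesc : ∀ {xs} → v ∉ xs → otherParts v (insertDesc v xs) ≡ xs
  otherParts-insertDesc {[]}     _  = otherParts-self []
  otherParts-insertDesc {x ∷ xs} v∉ with v <? x
  ... | yes _ = trans (otherParts-other (insertDesc v xs) (λ x≡v → v∉ (here (sym x≡v))))
                      (cong (x ∷_) (otherParts-insertDesc (v∉ ∘ there)))
  ... | no  _ = trans (otherParts-self (x ∷ xs)) (otherParts-∉ v∉)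

sum-map-suc : ∀ xs → sum (map suc xs) ≡ length xs + sum xs
sum-map-suc []       = refl
sum-map-suc (x ∷ xs) = trans (cong (λ s → suc x + s) (sum-map-suc xs)) (shuffle x (length xs) (sum xs))
  where
  shuffle : ∀ x l s → suc x + (l + s) ≡ suc l + (x + s)
  shuffle = ℕ-Ring.solve-∀

sum-replicate : ∀ k x → sum (replicate k x) ≡ k * x
sum-replicate zero    x = refl
sum-replicate (suc k) x = cong (λ s → x + s) (sum-replicate k x)

map-pred-suc : ∀ xs → map pred (map suc xs) ≡ xs
map-pred-suc xs = trans (sym (map-∘ xs)) (map-id xs)

map-suc-pred : ∀ {xs} → All (0 <_) xs → map suc (map pred xs) ≡ xs
map-suc-pred {xs} xs⁺ = trans (sym (map-∘ xs)) (map-id-local (All.map (λ { {suc _} _ → refl }) xs⁺))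

map-suc-above : ∀ {lo xs} → DistinctAbove lo xs → DistinctAbove (suc lo) (map suc xs)
map-suc-above (xs↓ , lo<xs) = AllPairs.map⁺ (AllPairs.map s≤s xs↓) , All.map⁺ (All.map s≤s lo<xs)

map-suc-above⁻ : ∀ {lo xs} → DistinctAbove (suc lo) (map suc xs) → DistinctAbove lo xs
map-suc-above⁻ (sxs↓ , slo<sxs) = AllPairs.map s<s⁻¹ (AllPairs.map⁻ sxs↓) , All.map s<s⁻¹ (All.map⁻ slo<sxs)

map-pred-above : ∀ {lo xs} → DistinctAbove (suc lo) xs → DistinctAbove lo (map pred xs)
map-pred-above {lo} {xs} xs↑ =
  map-suc-above⁻ (subst (DistinctAbove (suc lo)) (sym (map-suc-pred (All.map (<-trans z<s) (proj₂ xs↑)))) xs↑)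

otherParts-above : ∀ {lo v xs} → DistinctAbove lo xs → DistinctAbove lo (otherParts v xs)
otherParts-above {v = v} (xs↓ , lo<xs) =
  AllPairs.filter⁺ (λ x → ¬? (x ≟ v)) xs↓ , All.filter⁺ (λ x → ¬? (x ≟ v)) lo<xs

smallest-last : ∀ {j xs} → NonIncreasing xs → All (j ≤_) xs → xs ≡ otherParts j xs ++ replicate (mult j xs) j
smallest-last {j} {[]}     []           []            = refl
smallest-last {j} {x ∷ xs} (x≥xs ∷ xs↓) (j≤x ∷ j≤xs) with x ≟ j
... | no x≢j = begin
  x ∷ xs                                                ≡⟨ cong (x ∷_) (smallest-last xs↓ j≤xs) ⟩
  x ∷ (otherParts j xs ++ replicate (mult j xs) j)      ≡⟨ cong₂ (λ o m → o ++ replicate m j)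
                                                             (otherParts-other xs x≢j) (mult-other xs x≢j) ⟨
  otherParts j (x ∷ xs) ++ replicate (mult j (x ∷ xs)) j ∎
  where open ≡-Reasoning
... | yes refl = begin
  x ∷ xs                                                ≡⟨ cong (x ∷_) (smallest-last xs↓ j≤xs) ⟩
  x ∷ (otherParts x xs ++ replicate (mult x xs) x)      ≡⟨ cong (λ o → x ∷ (o ++ replicate (mult x xs) x)) none ⟩
  x ∷ replicate (mult x xs) x                           ≡⟨ cong₂ (λ o m → o ++ replicate m x)
                                                             (trans (otherParts-self xs) none) (mult-self xs) ⟨
  otherParts x (x ∷ xs) ++ replicate (mult x (x ∷ xs)) x ∎
  where
  open ≡-Reasoning
  none : otherParts x xs ≡ []
  none = filter-none (λ y → ¬? (y ≟ x)) (All.zipWith (λ (y≤x , x≤y) y≢x → y≢x (≤-antisym y≤x x≤y)) (x≥xs , j≤xs))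

module _ {j : ℕ} {μ : List ℕ} (μ≢j : All (_≢ j) μ) where

  otherParts-++-replicate : ∀ k → otherParts j (μ ++ replicate k j) ≡ μ
  otherParts-++-replicate k = begin
    otherParts j (μ ++ replicate k j)
      ≡⟨ filter-++ (λ x → ¬? (x ≟ j)) μ (replicate k j) ⟩
    otherParts j μ ++ otherParts j (replicate k j)
      ≡⟨ cong₂ _++_ (filter-all (λ x → ¬? (x ≟ j)) μ≢j)
                    (filter-none (λ x → ¬? (x ≟ j)) (All.replicate⁺ k (λ j≢j → j≢j refl))) ⟩
    μ ++ []
      ≡⟨ ++-identityʳ μ ⟩
    μ ∎
    where open ≡-Reasoning

  mult-++-replicate : ∀ k → mult j (μ ++ replicate k j) ≡ k
  mult-++-replicate k = begin
    length (filter (_≟ j) (μ ++ replicate k j))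
      ≡⟨ cong length (filter-++ (_≟ j) μ (replicate k j)) ⟩
    length (filter (_≟ j) μ ++ filter (_≟ j) (replicate k j))
      ≡⟨ length-++ (filter (_≟ j) μ) ⟩
    length (filter (_≟ j) μ) + length (filter (_≟ j) (replicate k j))
      ≡⟨ cong₂ (λ a c → length a + length c) (filter-none (_≟ j) μ≢j) (filter-all (_≟ j) (All.replicate⁺ k refl)) ⟩
    length (replicate k j)
      ≡⟨ length-replicate k ⟩
    k ∎
    where open ≡-Reasoning

module _ (ℓ : ℕ) where

  Counted : ℕ → List ℕ → Set
  Counted zero    = Distinct
  Counted (suc i) = SmallestRep ℓ (suc i)

  counted? : ∀ j λs → Dec (Counted j λs)
  counted? zero    = distinct?
  counted? (suc i) = smallestRep? ℓ (suc i)

  rest : ℕ → List ℕ → List ℕ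
  rest zero    λs = λs
  rest (suc i) λs = otherParts (suc i) λs

  withBlock : ℕ → List ℕ → List ℕ
  withBlock zero    μ = μ
  withBlock (suc i) μ = μ ++ replicate (suc i + ℓ) (suc i)

  -- 2 * j comes first so that pivot 0 μ reduces to length μ + ℓ and P∉ 0 is b ℓ by definition.
  pivot : ℕ → List ℕ → ℕ
  pivot j μ = 2 * j + (length μ + ℓ)

  weight : ℕ → List ℕ → ℕ
  weight j μ = sum μ + (j + ℓ) * j

  sum-withBlock : ∀ j μ → sum (withBlock j μ) ≡ weight j μ
  sum-withBlock zero    μ = sym (trans (cong (λ w → sum μ + w) (*-zeroʳ ℓ)) (+-identityʳ (sum μ)))
  sum-withBlock (suc i) μ =
    trans (sum-++ μ (replicate (suc i + ℓ) (suc i))) (cong (λ s → sum μ + s) (sum-replicate (suc i + ℓ) (suc i)))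

  j≤weight : ∀ j μ → j ≤ weight j μ
  j≤weight zero    μ = z≤n
  j≤weight (suc i) μ = ≤-trans (m≤n*m (suc i) (suc i + ℓ)) (m≤n+m _ (sum μ))

  decompose : ∀ j {λs} → IsPartition λs → Counted j λs →
              DistinctAbove j (rest j λs) × withBlock j (rest j λs) ≡ λs
  decompose zero    (λs↓ , λs⁺) λs! = (nonIncreasing∧unique⇒decreasing λs↓ λs! , λs⁺) , refl
  decompose (suc i) {λs} (λs↓ , _) (j≤λs , mult≡ , μ!) = (μ↓ , j<μ) , sym λs≡
    where
    j : ℕ
    j = suc i
    μ↓ : Decreasing (otherParts j λs)
    μ↓ = nonIncreasing∧unique⇒decreasing (AllPairs.filter⁺ (λ x → ¬? (x ≟ j)) λs↓) μ!
    j<μ : All (j <_) (otherParts j λs)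
    j<μ = All.zipWith (λ (j≤x , x≢j) → ≤∧≢⇒< j≤x (x≢j ∘ sym))
            (All.filter⁺ (λ x → ¬? (x ≟ j)) j≤λs , All.all-filter (λ x → ¬? (x ≟ j)) λs)
    λs≡ : λs ≡ otherParts j λs ++ replicate (j + ℓ) j
    λs≡ = trans (smallest-last λs↓ j≤λs) (cong (λ k → otherParts j λs ++ replicate k j) mult≡)

  compose : ∀ j {μ} → DistinctAbove j μ →
            IsPartition (withBlock j μ) × Counted j (withBlock j μ) × rest j (withBlock j μ) ≡ μ
  compose zero    (μ↓ , μ⁺) = (decreasing⇒nonIncreasing μ↓ , μ⁺) , decreasing⇒unique μ↓ , refl
  compose (suc i) {μ} (μ↓ , j<μ) =
    (λs↓ , λs⁺)
    , (j≤λs , mult-++-replicate μ≢j (j + ℓ) , subst Unique (sym rest≡μ) (decreasing⇒unique μ↓))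
    , rest≡μ
    where
    j : ℕ
    j = suc i
    μ≢j : All (_≢ j) μ
    μ≢j = All.map >⇒≢ j<μ
    rest≡μ : otherParts j (μ ++ replicate (j + ℓ) j) ≡ μ
    rest≡μ = otherParts-++-replicate μ≢j (j + ℓ)
    block↓ : ∀ k → NonIncreasing (replicate k j)
    block↓ zero    = []
    block↓ (suc k) = All.replicate⁺ k ≤-refl ∷ block↓ k
    λs↓ : NonIncreasing (μ ++ replicate (j + ℓ) j)
    λs↓ = AllPairs.++⁺ (decreasing⇒nonIncreasing μ↓) (block↓ (j + ℓ))
            (All.map (λ j<x → All.replicate⁺ (j + ℓ) (<⇒≤ j<x)) j<μ)
    λs⁺ : All (0 <_) (μ ++ replicate (j + ℓ) j)
    λs⁺ = All.++⁺ (All.map (<-trans z<s) j<μ) (All.replicate⁺ (j + ℓ) z<s)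
    j≤λs : All (j ≤_) (μ ++ replicate (j + ℓ) j)
    j≤λs = All.++⁺ (All.map <⇒≤ j<μ) (All.replicate⁺ (j + ℓ) ≤-refl)

  pivot-∷ : ∀ j x xs → pivot j (x ∷ xs) ≡ suc (pivot j xs)
  pivot-∷ j x xs = +-suc (2 * j) (length xs + ℓ)

  pivot-suc : ∀ j xs → pivot (suc j) xs ≡ suc (suc (pivot j xs))
  pivot-suc j xs = shuffle j (length xs + ℓ)
    where
    shuffle : ∀ j a → 2 * suc j + a ≡ suc (suc (2 * j + a))
    shuffle = ℕ-Ring.solve-∀

  pivot-map : ∀ j f xs → pivot j (map f xs) ≡ pivot j xs
  pivot-map j f xs = cong (λ n → 2 * j + (n + ℓ)) (length-map f xs)

  pivot-↭ : ∀ j {xs ys} → xs ↭ ys → pivot j xs ≡ pivot j ys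
  pivot-↭ j xs↭ys = cong (λ n → 2 * j + (n + ℓ)) (↭-length xs↭ys)

  weight-↭ : ∀ j {xs ys} → xs ↭ ys → weight j xs ≡ weight j ys
  weight-↭ j xs↭ys = cong (λ s → s + (j + ℓ) * j) (sum-↭ xs↭ys)

  weight-map-suc : ∀ j xs → weight (suc j) (map suc xs) ≡ weight j (suc (pivot j xs) ∷ xs)
  weight-map-suc j xs =
    trans (cong (λ s → s + (suc j + ℓ) * suc j) (sum-map-suc xs)) (shuffle j (length xs) (sum xs) ℓ)
    where
    shuffle : ∀ j l s k → l + s + (suc j + k) * suc j ≡ (suc (2 * j + (l + k)) + s) + (j + k) * j
    shuffle = ℕ-Ring.solve-∀

  dropPivot : ℕ → List ℕ → List ℕ
  dropPivot j μ = map suc (otherParts (pivot j μ) μ)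

  addPivot : ℕ → List ℕ → List ℕ
  addPivot j ν = insertDesc (suc (pivot j ν)) (map pred ν)

  module _ {j μ} (μ↑ : DistinctAbove j μ) (v∈μ : pivot j μ ∈ μ) where

    private
      v : ℕ
      v = pivot j μ
      r : List ℕ
      r = otherParts v μ

      μ↭ : μ ↭ v ∷ r
      μ↭ = otherParts-↭ (decreasing⇒unique (proj₁ μ↑)) v∈μ

      v≡ : v ≡ suc (pivot j r)
      v≡ = trans (pivot-↭ j μ↭) (pivot-∷ j v r)

    pivot-dropPivot : pivot (suc j) (dropPivot j μ) ≡ suc v
    pivot-dropPivot = begin
      pivot (suc j) (map suc r)       ≡⟨ pivot-suc j (map suc r) ⟩
      suc (suc (pivot j (map suc r))) ≡⟨ cong (suc ∘ suc) (pivot-map j suc r) ⟩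
      suc (suc (pivot j r))           ≡⟨ cong suc v≡ ⟨
      suc v                           ∎
      where open ≡-Reasoning

    dropPivot-above : DistinctAbove (suc j) (dropPivot j μ)
    dropPivot-above = map-suc-above (otherParts-above μ↑)

    pivot∉dropPivot : pivot (suc j) (dropPivot j μ) ∉ dropPivot j μ
    pivot∉dropPivot sv∈ with _ , v′∈r , eq ← ∈-map⁻ suc sv∈ =
      ∉-otherParts μ (subst (_∈ r) (sym (suc-injective (trans (sym pivot-dropPivot) eq))) v′∈r)

    weight-dropPivot : weight (suc j) (dropPivot j μ) ≡ weight j μ
    weight-dropPivot = begin
      weight (suc j) (map suc r)      ≡⟨ weight-map-suc j r ⟩
      weight j (suc (pivot j r) ∷ r)  ≡⟨ cong (λ p → weight j (p ∷ r)) v≡ ⟨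
      weight j (v ∷ r)                ≡⟨ weight-↭ j μ↭ ⟨
      weight j μ                      ∎
      where open ≡-Reasoning

    addPivot-dropPivot : addPivot j (dropPivot j μ) ≡ μ
    addPivot-dropPivot = begin
      insertDesc (suc (pivot j (map suc r))) (map pred (map suc r))
        ≡⟨ cong₂ insertDesc (cong suc (pivot-map j suc r)) (map-pred-suc r) ⟩
      insertDesc (suc (pivot j r)) r
        ≡⟨ cong (λ p → insertDesc p r) v≡ ⟨
      insertDesc v r
        ≡⟨ insertDesc-otherParts (proj₁ μ↑) v∈μ ⟩
      μ ∎
      where open ≡-Reasoning

  module _ {j ν} (ν↑ : DistinctAbove (suc j) ν) (v∉ν : pivot (suc j) ν ∉ ν) where

    private
      w : ℕ
      w = suc (pivot j ν)
      ν′ : List ℕ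
      ν′ = map pred ν
      ν′↑ : DistinctAbove j ν′
      ν′↑ = map-pred-above ν↑

      suc-ν′ : map suc ν′ ≡ ν
      suc-ν′ = map-suc-pred (All.map (<-trans z<s) (proj₂ ν↑))

      w≡ : w ≡ suc (pivot j ν′)
      w≡ = cong suc (sym (pivot-map j pred ν))

      w∉ν′ : w ∉ ν′
      w∉ν′ w∈ = v∉ν (subst₂ _∈_ (sym (pivot-suc j ν)) suc-ν′ (∈-map⁺ suc w∈))

      addPivot↭ : addPivot j ν ↭ w ∷ ν′
      addPivot↭ = insertDesc-↭ w ν′

    pivot-addPivot : pivot j (addPivot j ν) ≡ w
    pivot-addPivot = trans (trans (pivot-↭ j addPivot↭) (pivot-∷ j w ν′)) (sym w≡)

    addPivot-above : DistinctAbove j (addPivot j ν)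
    addPivot-above = insertDesc-decreasing (proj₁ ν′↑) w∉ν′ , All-resp-↭ (↭-sym addPivot↭) (j<w ∷ proj₂ ν′↑)
      where
      j<w : j < w
      j<w = s≤s (≤-trans (m≤m+n j (j + 0)) (m≤m+n (2 * j) (length ν + ℓ)))

    pivot∈addPivot : pivot j (addPivot j ν) ∈ addPivot j ν
    pivot∈addPivot = subst (_∈ addPivot j ν) (sym pivot-addPivot) (∈-resp-↭ (↭-sym addPivot↭) (here refl))

    weight-addPivot : weight j (addPivot j ν) ≡ weight (suc j) ν
    weight-addPivot = begin
      weight j (addPivot j ν)          ≡⟨ weight-↭ j addPivot↭ ⟩
      weight j (w ∷ ν′)                ≡⟨ cong (λ p → weight j (p ∷ ν′)) w≡ ⟩
      weight j (suc (pivot j ν′) ∷ ν′) ≡⟨ weight-map-suc j ν′ ⟨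
      weight (suc j) (map suc ν′)      ≡⟨ cong (weight (suc j)) suc-ν′ ⟩
      weight (suc j) ν                 ∎
      where open ≡-Reasoning

    dropPivot-addPivot : dropPivot j (addPivot j ν) ≡ ν
    dropPivot-addPivot = begin
      map suc (otherParts (pivot j (addPivot j ν)) (addPivot j ν))
        ≡⟨ cong (λ p → map suc (otherParts p (addPivot j ν))) pivot-addPivot ⟩
      map suc (otherParts w (insertDesc w ν′))
        ≡⟨ cong (map suc) (otherParts-insertDesc w∉ν′) ⟩
      map suc ν′
        ≡⟨ suc-ν′ ⟩
      ν ∎
      where open ≡-Reasoning

  counted-decompose : ∀ j {n λs} → λs ∈ partitions n → Counted j λs →
    DistinctAbove j (rest j λs) × withBlock j (rest j λs) ≡ λs × weight j (rest j λs) ≡ n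
  counted-decompose j {n} {λs} λs∈ c
    with λs⇃ , Σλs ← ∈-partitions⁻ λs∈
    with μ↑ , block≡ ← decompose j λs⇃ c
    = μ↑ , block≡ , trans (sym (sum-withBlock j (rest j λs))) (trans (cong sum block≡) Σλs)

  counted-compose : ∀ j {n μ} → DistinctAbove j μ → weight j μ ≡ n →
    withBlock j μ ∈ partitions n × Counted j (withBlock j μ) × rest j (withBlock j μ) ≡ μ
  counted-compose j {n} {μ} μ↑ wt with λs⇃ , c , rest≡ ← compose j μ↑ =
    subst (λ m → withBlock j μ ∈ partitions m) (trans (sum-withBlock j μ) wt) (∈-partitions⁺ λs⇃) , c , rest≡

  HasPivot : ℕ → List ℕ → Set
  HasPivot j λs = pivot j (rest j λs) ∈ rest j λs

  pivotIn? : ∀ j λs → Dec (HasPivot j λs)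
  pivotIn? j λs = pivot j (rest j λs) ∈? rest j λs

  withPivot? : ∀ j λs → Dec (Counted j λs × HasPivot j λs)
  withoutPivot? : ∀ j λs → Dec (Counted j λs × ¬ HasPivot j λs)
  withPivot?    j λs = counted? j λs ×-dec pivotIn? j λs
  withoutPivot? j λs = counted? j λs ×-dec ¬? (pivotIn? j λs)

  P∈ P∉ : ℕ → ℕ → ℕ
  P∈ j = countParts (withPivot? j)
  P∉ j = countParts (withoutPivot? j)

  P-split : ∀ j n → P ℓ j n ≡ P∈ j n + P∉ j n
  P-split zero    n = length-filter-split (counted? 0) (pivotIn? 0) (partitions n)
  P-split (suc i) n = length-filter-split (counted? (suc i)) (pivotIn? (suc i)) (partitions n)

  P∉-vanishes : ∀ n → P∉ (suc n) n ≡ 0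
  P∉-vanishes n =
    cong length (filter-none (withoutPivot? (suc n)) (All.tabulate (λ λs∈ (c , _) → not-counted λs∈ c)))
    where
    not-counted : ∀ {λs} → λs ∈ partitions n → ¬ Counted (suc n) λs
    not-counted {λs} λs∈ c with _ , _ , wt ← counted-decompose (suc n) λs∈ c =
      n≮n n (subst (suc n ≤_) wt (j≤weight (suc n) (rest (suc n) λs)))

  toNext toPrev : ℕ → List ℕ → List ℕ
  toNext j λs = withBlock (suc j) (dropPivot j (rest j λs))
  toPrev j λs = withBlock j (addPivot j (rest (suc j) λs))

  module _ {j n : ℕ} where

    toNext-toPrev : ∀ {λs} → λs ∈ filter (withPivot? j) (partitions n) →
      toNext j λs ∈ filter (withoutPivot? (suc j)) (partitions n) × toPrev j (toNext j λs) ≡ λs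
    toNext-toPrev {λs} λs∈
      with λs∈n , c , v∈ ← ∈-filter⁻ (withPivot? j) {xs = partitions n} λs∈
      with μ↑ , block≡ , wt ← counted-decompose j {n} λs∈n c
      with λs′∈ , c′ , rest≡ ← counted-compose (suc j) (dropPivot-above μ↑ v∈)
                                                (trans (weight-dropPivot μ↑ v∈) wt)
      = ∈-filter⁺ (withoutPivot? (suc j)) λs′∈
          (c′ , subst (λ ν → pivot (suc j) ν ∉ ν) (sym rest≡) (pivot∉dropPivot μ↑ v∈))
      , (begin
        withBlock j (addPivot j (rest (suc j) (toNext j λs))) ≡⟨ cong (withBlock j ∘ addPivot j) rest≡ ⟩
        withBlock j (addPivot j (dropPivot j (rest j λs)))    ≡⟨ cong (withBlock j) (addPivot-dropPivot μ↑ v∈) ⟩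
        withBlock j (rest j λs)                               ≡⟨ block≡ ⟩
        λs                                                    ∎)
      where open ≡-Reasoning

    toPrev-toNext : ∀ {λs} → λs ∈ filter (withoutPivot? (suc j)) (partitions n) →
      toPrev j λs ∈ filter (withPivot? j) (partitions n) × toNext j (toPrev j λs) ≡ λs
    toPrev-toNext {λs} λs∈
      with λs∈n , c , v∉ ← ∈-filter⁻ (withoutPivot? (suc j)) {xs = partitions n} λs∈
      with ν↑ , block≡ , wt ← counted-decompose (suc j) {n} λs∈n c
      with λs′∈ , c′ , rest≡ ← counted-compose j (addPivot-above ν↑ v∉)
                                                (trans (weight-addPivot ν↑ v∉) wt)
      = ∈-filter⁺ (withPivot? j) λs′∈
          (c′ , subst (λ μ → pivot j μ ∈ μ) (sym rest≡) (pivot∈addPivot ν↑ v∉))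
      , (begin
        withBlock (suc j) (dropPivot j (rest j (toPrev j λs)))
          ≡⟨ cong (withBlock (suc j) ∘ dropPivot j) rest≡ ⟩
        withBlock (suc j) (dropPivot j (addPivot j (rest (suc j) λs)))
          ≡⟨ cong (withBlock (suc j)) (dropPivot-addPivot ν↑ v∉) ⟩
        withBlock (suc j) (rest (suc j) λs)
          ≡⟨ block≡ ⟩
        λs ∎)
      where open ≡-Reasoning

  P∈≡P∉-suc : ∀ j n → P∈ j n ≡ P∉ (suc j) n
  P∈≡P∉-suc j n = length-≡-by-inverses (toNext j) (toPrev j)
    (Unique.filter⁺ (withPivot? j) (partitions-unique n))
    (Unique.filter⁺ (withoutPivot? (suc j)) (partitions-unique n))
    (toNext-toPrev {j} {n}) (toPrev-toNext {j} {n})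

telescope : ∀ (c d : ℕ → ℤ) → (∀ j → c j ≡ d j ℤ.- d (suc j)) →
            ∀ m → foldr ℤ._+_ 0ℤ (applyUpTo c m) ≡ d 0 ℤ.- d m
telescope c d c≡ zero    = sym (ℤ.+-inverseʳ (d 0))
telescope c d c≡ (suc m) = begin
  c 0 ℤ.+ foldr ℤ._+_ 0ℤ (applyUpTo (c ∘ suc) m)
    ≡⟨ cong₂ ℤ._+_ (c≡ 0) (telescope (c ∘ suc) (d ∘ suc) (c≡ ∘ suc) m) ⟩
  (d 0 ℤ.- d 1) ℤ.+ (d 1 ℤ.- d (suc m))
    ≡⟨ cancel (d 0) (d 1) (d (suc m)) ⟩
  d 0 ℤ.- d (suc m) ∎
  where
  open ≡-Reasoning
  cancel : ∀ x y z → (x ℤ.- y) ℤ.+ (y ℤ.- z) ≡ x ℤ.- z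
  cancel = ℤ-Ring.solve-∀

alternating-telescope : ∀ (h a : ℕ → ℕ) → (∀ j → h j ≡ a (suc j) + a j) → ∀ m → a m ≡ 0 →
  foldr ℤ._+_ 0ℤ (applyUpTo (λ j → -1ℤ ℤ.^ j ℤ.* + h j) m) ≡ + a 0
alternating-telescope h a h≡ m aₘ≡0 = begin
  foldr ℤ._+_ 0ℤ (applyUpTo (λ j → -1ℤ ℤ.^ j ℤ.* + h j) m) ≡⟨ telescope _ signed split m ⟩
  signed 0 ℤ.- -1ℤ ℤ.^ m ℤ.* + a m                        ≡⟨ cong (λ k → signed 0 ℤ.- -1ℤ ℤ.^ m ℤ.* + k) aₘ≡0 ⟩
  signed 0 ℤ.- -1ℤ ℤ.^ m ℤ.* 0ℤ                           ≡⟨ drop (+ a 0) (-1ℤ ℤ.^ m) ⟩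
  + a 0                                                   ∎
  where
  open ≡-Reasoning
  signed : ℕ → ℤ
  signed j = -1ℤ ℤ.^ j ℤ.* + a j
  split : ∀ j → -1ℤ ℤ.^ j ℤ.* + h j ≡ signed j ℤ.- signed (suc j)
  split j = trans (cong (λ k → -1ℤ ℤ.^ j ℤ.* k) (trans (cong +_ (h≡ j)) (ℤ.pos-+ (a (suc j)) (a j))))
                  (flip-sign (-1ℤ ℤ.^ j) (+ a (suc j)) (+ a j))
    where
    flip-sign : ∀ s x y → s ℤ.* (x ℤ.+ y) ≡ s ℤ.* y ℤ.- (-1ℤ ℤ.* s) ℤ.* x
    flip-sign = ℤ-Ring.solve-∀
  drop : ∀ x t → ℤ.1ℤ ℤ.* x ℤ.- t ℤ.* 0ℤ ≡ x
  drop = ℤ-Ring.solve-∀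

theorem4p7 : (ℓ n : ℕ) → altSum ℓ n ≡ + b ℓ n
theorem4p7 ℓ n = begin
  altSum ℓ n
    ≡⟨ cong (foldr ℤ._+_ 0ℤ) (map-upTo (λ j → -1ℤ ℤ.^ j ℤ.* + P ℓ j n) (suc n)) ⟩
  foldr ℤ._+_ 0ℤ (applyUpTo (λ j → -1ℤ ℤ.^ j ℤ.* + P ℓ j n) (suc n))
    ≡⟨ alternating-telescope (λ j → P ℓ j n) (λ j → P∉ ℓ j n) P≡P∉-suc+P∉ (suc n) (P∉-vanishes ℓ n) ⟩
  + P∉ ℓ 0 n
    ≡⟨⟩
  + b ℓ n ∎
  where
  open ≡-Reasoning
  P≡P∉-suc+P∉ : ∀ j → P ℓ j n ≡ P∉ ℓ (suc j) n + P∉ ℓ j n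
  P≡P∉-suc+P∉ j = trans (P-split ℓ j n) (cong (λ k → k + P∉ ℓ j n) (P∈≡P∉-suc ℓ j n))
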